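{- For every term $\mathfrak{t}$ over the alphabet $\{\mathsf{M}\}$ (possibly containing variables), the poset $\mathcal{P}(\mathfrak{t}) = \{\mathfrak{t}' : \mathfrak{t} \preccurlyeq \mathfrak{t}'\}$, ordered by $\preccurlyeq$, is a finite lattice.
   Context: Terms over $\{\mathsf{M}\}$: every variable $\mathsf{x}_i$ ($i \geq 1$) is a term, the constant $\mathsf{M}$ is a term, and if $\mathfrak{t}_1,\mathfrak{t}_2$ are terms then so is their application $\mathfrak{t}_1\mathfrak{t}_2$ (a binary tree with root having left subtree $\mathfrak{t}_1$ and right subtree $\mathfrak{t}_2$; juxtaposition associates to the left). The one-step rewrite relation $\Rightarrow$ is defined by: $\mathfrak{t} \Rightarrow \mathfrak{t}'$ iff $\mathfrak{t}'$ is obtained from $\mathfrak{t}$ by replacing one subterm of the form $\mathsf{M}\mathfrak{s}$ (for some term $\mathfrak{s}$) by $\mathfrak{s}\mathfrak{s}$ (this is the context closure of the rule $\mathsf{M}\mathsf{x}_1 \to \mathsf{x}_1\mathsf{x}_1$). The relation $\preccurlyeq$ is the reflexive and transitive closure of $\Rightarrow$; it is a partial order on the set of all terms. -}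

module Defs where

open import Data.Nat using (ℕ)
open import Data.Product using (Σ; proj₁)
open import Data.List using (List)
open import Data.List.Membership.Propositional using (_∈_)
open import Relation.Binary.PropositionalEquality using (_≡_)
open import Relation.Binary.Construct.Closure.ReflexiveTransitive using (Star)
open import Relation.Binary.Lattice.Structures using (IsLattice)

data Term : Set where
  var : ℕ → Term
  M   : Term
  _·_ : Term → Term → Term

infixl 7 _·_

data _⇒_ : Term → Term → Set where
  here  : ∀ s → (M · s) ⇒ (s · s)
  left  : ∀ {t₁ t₁'} t₂ → t₁ ⇒ t₁' → (t₁ · t₂) ⇒ (t₁' · t₂)
  right : ∀ t₁ {t₂ t₂'} → t₂ ⇒ t₂' → (t₁ · t₂) ⇒ (t₁ · t₂')

_≼_ : Term → Term → Set
_≼_ = Star _⇒_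

P : Term → Set
P t = Σ Term (λ t' → t ≼ t')

_≈P_ : ∀ {t} → P t → P t → Set
a ≈P b = proj₁ a ≡ proj₁ b

_≼P_ : ∀ {t} → P t → P t → Set
a ≼P b = proj₁ a ≼ proj₁ b

IsFiniteP : Term → Set
IsFiniteP t = Σ (List Term) (λ xs → ∀ t' → t ≼ t' → t' ∈ xs)

IsLatticeP : Term → Set
IsLatticeP t = Σ (P t → P t → P t) (λ _∨_ → Σ (P t → P t → P t) (λ _∧_ →
  IsLattice (_≈P_ {t}) (_≼P_ {t}) _∨_ _∧_))

-- Every reduct of M · b is either M · b' or c · d with b', c and d reducts of b,
-- and every reduct of any other application is formed componentwise.  This gives
-- a syntax-directed description _⊑_ of ≼, made unambiguous by allowing the
-- duplication only for b ≠ M (for b = M it yields nothing new).  From it: the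
-- reducts of t are among finitely many terms, ≼ is antisymmetric, and joins and
-- meets are computed by recursion, the only new cases being those pairing M · b'
-- with c · d, whose join is (b' ∨ c) · (b' ∨ d) and whose meet is M · (b' ∧ c ∧ d).
module Submission where

open import Defs
open import Data.Product using (_×_; _,_; proj₁)
open import Data.Empty using (⊥-elim)
open import Data.List using (List; []; _∷_; _++_; cartesianProductWith)
open import Data.List.Membership.Propositional using (_∈_)
open import Data.List.Membership.Propositional.Properties
  using (∈-++⁺ˡ; ∈-++⁺ʳ; ∈-cartesianProductWith⁺)
open import Data.List.Relation.Unary.Any using (here)
open import Relation.Nullary using (¬_)
open import Relation.Binary.PropositionalEquality using (_≡_; refl; cong₂)
open import Relation.Binary.Structures using (IsPartialOrder)
open import Relation.Binary.Lattice.Structures using (IsLattice)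
open import Relation.Binary.Construct.Closure.ReflexiveTransitive using (ε; _◅_; _◅◅_; gmap)
import Relation.Binary.Construct.Closure.ReflexiveTransitive.Properties as Star
import Relation.Binary.Construct.On as On

data NonM : Term → Set where
  var : ∀ {n} → NonM (var n)
  app : ∀ {a b} → NonM (a · b)

infix 4 _⊑_

data _⊑_ : Term → Term → Set where
  var : ∀ n → var n ⊑ var n
  M   : M ⊑ M
  _·_ : ∀ {a a' b b'} → a ⊑ a' → b ⊑ b' → a · b ⊑ a' · b'
  dup : ∀ {b c d} → NonM b → b ⊑ c → b ⊑ d → M · b ⊑ c · d

⊑-refl : ∀ t → t ⊑ t
⊑-refl (var n) = var n
⊑-refl M       = M
⊑-refl (a · b) = ⊑-refl a · ⊑-refl b

⊑-dup : ∀ {b c d} → b ⊑ c → b ⊑ d → M · b ⊑ c · d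
⊑-dup M             q = M · q
⊑-dup p@(var _)     q = dup var p q
⊑-dup p@(_ · _)     q = dup app p q
⊑-dup p@(dup _ _ _) q = dup app p q

NonM-⊑ : ∀ {b c} → NonM b → b ⊑ c → NonM c
NonM-⊑ var (var _)     = var
NonM-⊑ app (_ · _)     = app
NonM-⊑ app (dup _ _ _) = app

⊑-step : ∀ {t u v} → t ⊑ u → u ⇒ v → t ⊑ v
⊑-step (M · q)       (here _)    = ⊑-dup q q
⊑-step (dup () M _)  (here _)
⊑-step (p · q)       (left _ s)  = ⊑-step p s · q
⊑-step (dup nm p q)  (left _ s)  = dup nm (⊑-step p s) q
⊑-step (p · q)       (right _ s) = p · ⊑-step q s
⊑-step (dup nm p q)  (right _ s) = dup nm p (⊑-step q s)

≼⇒⊑ : ∀ {t u} → t ≼ u → t ⊑ u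
≼⇒⊑ = go (⊑-refl _)
  where
  go : ∀ {t u v} → t ⊑ u → u ≼ v → t ⊑ v
  go p ε        = p
  go p (s ◅ ss) = go (⊑-step p s) ss

·-monoˡ-≼ : ∀ {a a'} b → a ≼ a' → (a · b) ≼ (a' · b)
·-monoˡ-≼ b = gmap (_· b) (left b)

·-monoʳ-≼ : ∀ a {b b'} → b ≼ b' → (a · b) ≼ (a · b')
·-monoʳ-≼ a = gmap (a ·_) (right a)

⊑⇒≼ : ∀ {t u} → t ⊑ u → t ≼ u
⊑⇒≼ (var _) = ε
⊑⇒≼ M       = ε
⊑⇒≼ (_·_ {a' = a'} {b = b} p q) = ·-monoˡ-≼ b (⊑⇒≼ p) ◅◅ ·-monoʳ-≼ a' (⊑⇒≼ q)
⊑⇒≼ (dup {b} {c} _ p q) = here b ◅ (·-monoˡ-≼ b (⊑⇒≼ p) ◅◅ ·-monoʳ-≼ c (⊑⇒≼ q))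

⊑-trans : ∀ {t u v} → t ⊑ u → u ⊑ v → t ⊑ v
⊑-trans p q = ≼⇒⊑ (⊑⇒≼ p ◅◅ ⊑⇒≼ q)

⊑-antisym : ∀ {u v} → u ⊑ v → v ⊑ u → u ≡ v
⊑-antisym (var _)      _             = refl
⊑-antisym M            _             = refl
⊑-antisym (p · q)      (p' · q')     = cong₂ _·_ (⊑-antisym p p') (⊑-antisym q q')
⊑-antisym (M · _)      (dup () M _)
⊑-antisym (dup () M _) (M · _)
⊑-antisym (dup _ M _)  (dup () M _)

≼-isPartialOrder : IsPartialOrder _≡_ _≼_
≼-isPartialOrder = record
  { isPreorder = Star.isPreorder _⇒_
  ; antisym    = λ p q → ⊑-antisym (≼⇒⊑ p) (≼⇒⊑ q)
  }

reducts : Term → List Term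
reducts (var n) = var n ∷ []
reducts M       = M ∷ []
reducts (a · b) = cartesianProductWith _·_ (reducts a) (reducts b)
               ++ cartesianProductWith _·_ (reducts b) (reducts b)

∈-reducts : ∀ {t u} → t ⊑ u → u ∈ reducts t
∈-reducts (var _) = here refl
∈-reducts M       = here refl
∈-reducts (p · q) = ∈-++⁺ˡ (∈-cartesianProductWith⁺ _·_ (∈-reducts p) (∈-reducts q))
∈-reducts {M · b} (dup _ p q) =
  ∈-++⁺ʳ (cartesianProductWith _·_ (M ∷ []) (reducts b))
         (∈-cartesianProductWith⁺ _·_ (∈-reducts p) (∈-reducts q))

P-finite : ∀ t → IsFiniteP t
P-finite t = reducts t , λ _ r → ∈-reducts (≼⇒⊑ r)

M·⊑M·-inv : ∀ {b c} → M · b ⊑ M · c → b ⊑ c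
M·⊑M·-inv (M · q)      = q
M·⊑M·-inv (dup () M _)

M·⊑NonM·-inv : ∀ {b c d} → NonM c → M · b ⊑ c · d → b ⊑ c × b ⊑ d
M·⊑NonM·-inv ()  (M · _)
M·⊑NonM·-inv _   (dup _ p q) = p , q

NonM·⊑-inv : ∀ {a b c d} → NonM a → a · b ⊑ c · d → a ⊑ c × b ⊑ d
NonM·⊑-inv _  (p · q)     = p , q
NonM·⊑-inv () (dup _ _ _)

NonM·⋢M· : ∀ {a b c} → NonM a → ¬ (a · b ⊑ M · c)
NonM·⋢M· () (M · _)

join : ∀ {t u v} → t ⊑ u → t ⊑ v → Term
join (var n)     (var _)       = var n
join M           M             = M
join (p · q)     (p' · q')     = join p p' · join q q'
join (M · q)     (dup _ p' q') = join q p' · join q q'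
join (dup _ p q) (M · q')      = join p q' · join q q'
join (dup _ p q) (dup _ p' q') = join p p' · join q q'

⊑-join : ∀ {t u v} (p : t ⊑ u) (q : t ⊑ v) → t ⊑ join p q
⊑-join (var n)     (var _)       = var n
⊑-join M           M             = M
⊑-join (p · q)     (p' · q')     = ⊑-join p p' · ⊑-join q q'
⊑-join (M · q)     (dup _ p' q') = ⊑-dup (⊑-join q p') (⊑-join q q')
⊑-join (dup _ p q) (M · q')      = ⊑-dup (⊑-join p q') (⊑-join q q')
⊑-join (dup _ p q) (dup _ p' q') = ⊑-dup (⊑-join p p') (⊑-join q q')

join-upperˡ : ∀ {t u v} (p : t ⊑ u) (q : t ⊑ v) → u ⊑ join p q
join-upperˡ (var n)     (var _)       = var n
join-upperˡ M           M             = M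
join-upperˡ (p · q)     (p' · q')     = join-upperˡ p p' · join-upperˡ q q'
join-upperˡ (M · q)     (dup _ p' q') = ⊑-dup (join-upperˡ q p') (join-upperˡ q q')
join-upperˡ (dup _ p q) (M · q')      = join-upperˡ p q' · join-upperˡ q q'
join-upperˡ (dup _ p q) (dup _ p' q') = join-upperˡ p p' · join-upperˡ q q'

join-upperʳ : ∀ {t u v} (p : t ⊑ u) (q : t ⊑ v) → v ⊑ join p q
join-upperʳ (var n)     (var _)       = var n
join-upperʳ M           M             = M
join-upperʳ (p · q)     (p' · q')     = join-upperʳ p p' · join-upperʳ q q'
join-upperʳ (M · q)     (dup _ p' q') = join-upperʳ q p' · join-upperʳ q q'
join-upperʳ (dup _ p q) (M · q')      = ⊑-dup (join-upperʳ p q') (join-upperʳ q q')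
join-upperʳ (dup _ p q) (dup _ p' q') = join-upperʳ p p' · join-upperʳ q q'

join-least : ∀ {t u v z} (p : t ⊑ u) (q : t ⊑ v) → u ⊑ z → v ⊑ z → join p q ⊑ z
join-least (var _) (var _) x _ = x
join-least M       M       x _ = x
join-least (p · q) (p' · q') (x₁ · x₂) (y₁ · y₂) = join-least p p' x₁ y₁ · join-least q q' x₂ y₂
join-least (M · q) (M · q') (M · _) (dup () M _)
join-least (M · q) (M · q') (dup nm x₁ x₂) y =
  let (y₁ , y₂) = M·⊑NonM·-inv (NonM-⊑ nm x₁) y
  in  ⊑-dup (join-least q q' x₁ y₁) (join-least q q' x₂ y₂)
join-least (M · q) (dup nm p' q') x (y₁ · y₂) =
  let (x₁ , x₂) = M·⊑NonM·-inv (NonM-⊑ (NonM-⊑ nm p') y₁) x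
  in  join-least q p' x₁ y₁ · join-least q q' x₂ y₂
join-least (dup nm p q) (M · q') (x₁ · x₂) y =
  let (y₁ , y₂) = M·⊑NonM·-inv (NonM-⊑ (NonM-⊑ nm p) x₁) y
  in  join-least p q' x₁ y₁ · join-least q q' x₂ y₂
join-least (dup _ p q) (dup _ p' q') (x₁ · x₂) (y₁ · y₂) =
  join-least p p' x₁ y₁ · join-least q q' x₂ y₂
join-least (dup () M _) _ (dup _ _ _) _
join-least _ (dup () M _) _ (dup _ _ _)

meet : ∀ t {u v} → t ⊑ u → t ⊑ v → Term
⊑-meet : ∀ t {u v} (p : t ⊑ u) (q : t ⊑ v) → t ⊑ meet t p q

meet (var n) (var _)     (var _)       = var n
meet M       M           M             = M
meet (a · b) (p · q)     (p' · q')     = meet a p p' · meet b q q'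
meet (M · b) (M · q)     (dup _ p' q') = M · meet b q (⊑-meet b p' q')
meet (M · b) (dup _ p q) (M · q')      = M · meet b q' (⊑-meet b p q)
meet (M · b) (dup _ p q) (dup _ p' q') = meet b p p' · meet b q q'

⊑-meet (var n) (var _)     (var _)       = var n
⊑-meet M       M           M             = M
⊑-meet (a · b) (p · q)     (p' · q')     = ⊑-meet a p p' · ⊑-meet b q q'
⊑-meet (M · b) (M · q)     (dup _ p' q') = M · ⊑-meet b q (⊑-meet b p' q')
⊑-meet (M · b) (dup _ p q) (M · q')      = M · ⊑-meet b q' (⊑-meet b p q)
⊑-meet (M · b) (dup _ p q) (dup _ p' q') = ⊑-dup (⊑-meet b p p') (⊑-meet b q q')

meet-lowerˡ : ∀ t {u v} (p : t ⊑ u) (q : t ⊑ v) → meet t p q ⊑ u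
meet-lowerʳ : ∀ t {u v} (p : t ⊑ u) (q : t ⊑ v) → meet t p q ⊑ v

meet-lowerˡ (var n) (var _)     (var _)       = var n
meet-lowerˡ M       M           M             = M
meet-lowerˡ (a · b) (p · q)     (p' · q')     = meet-lowerˡ a p p' · meet-lowerˡ b q q'
meet-lowerˡ (M · b) (M · q)     (dup _ p' q') = M · meet-lowerˡ b q (⊑-meet b p' q')
meet-lowerˡ (M · b) (dup _ p q) (M · q')      =
  ⊑-dup (⊑-trans (meet-lowerʳ b q' (⊑-meet b p q)) (meet-lowerˡ b p q))
        (⊑-trans (meet-lowerʳ b q' (⊑-meet b p q)) (meet-lowerʳ b p q))
meet-lowerˡ (M · b) (dup _ p q) (dup _ p' q') = meet-lowerˡ b p p' · meet-lowerˡ b q q'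

meet-lowerʳ (var n) (var _)     (var _)       = var n
meet-lowerʳ M       M           M             = M
meet-lowerʳ (a · b) (p · q)     (p' · q')     = meet-lowerʳ a p p' · meet-lowerʳ b q q'
meet-lowerʳ (M · b) (M · q)     (dup _ p' q') =
  ⊑-dup (⊑-trans (meet-lowerʳ b q (⊑-meet b p' q')) (meet-lowerˡ b p' q'))
        (⊑-trans (meet-lowerʳ b q (⊑-meet b p' q')) (meet-lowerʳ b p' q'))
meet-lowerʳ (M · b) (dup _ p q) (M · q')      = M · meet-lowerˡ b q' (⊑-meet b p q)
meet-lowerʳ (M · b) (dup _ p q) (dup _ p' q') = meet-lowerʳ b p p' · meet-lowerʳ b q q'

meet-greatest : ∀ t {u v z} (p : t ⊑ u) (q : t ⊑ v) →
                t ⊑ z → z ⊑ u → z ⊑ v → z ⊑ meet t p q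
meet-greatest (var n) (var _) (var _) _ (var _) _ = var n
meet-greatest M       M       M       _ M       _ = M
meet-greatest (a · b) (p · q) (p' · q') (r₁ · r₂) (x₁ · x₂) (y₁ · y₂) =
  meet-greatest a p p' r₁ x₁ y₁ · meet-greatest b q q' r₂ x₂ y₂
meet-greatest (M · b) (M · q) (M · q') (M · r) x y =
  M · meet-greatest b q q' r (M·⊑M·-inv x) (M·⊑M·-inv y)
meet-greatest (M · b) (M · q) _ (dup nm r₁ _) x _ = ⊥-elim (NonM·⋢M· (NonM-⊑ nm r₁) x)
meet-greatest (M · b) _ (M · q') (dup nm r₁ _) _ y = ⊥-elim (NonM·⋢M· (NonM-⊑ nm r₁) y)
meet-greatest (M · b) (M · q) (dup nm p' q') (M · r) x y =
  let (y₁ , y₂) = M·⊑NonM·-inv (NonM-⊑ nm p') y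
  in  M · meet-greatest b q (⊑-meet b p' q') r (M·⊑M·-inv x) (meet-greatest b p' q' r y₁ y₂)
meet-greatest (M · b) (dup nm p q) (M · q') (M · r) x y =
  let (x₁ , x₂) = M·⊑NonM·-inv (NonM-⊑ nm p) x
  in  M · meet-greatest b q' (⊑-meet b p q) r (M·⊑M·-inv y) (meet-greatest b p q r x₁ x₂)
meet-greatest (M · b) (dup nm p q) (dup _ p' q') (M · r) x y =
  let (x₁ , x₂) = M·⊑NonM·-inv (NonM-⊑ nm p) x
      (y₁ , y₂) = M·⊑NonM·-inv (NonM-⊑ nm p') y
  in  ⊑-dup (meet-greatest b p p' r x₁ y₁) (meet-greatest b q q' r x₂ y₂)
meet-greatest (M · b) (dup _ p q) (dup _ p' q') (dup nm r₁ r₂) x y =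
  let (x₁ , x₂) = NonM·⊑-inv (NonM-⊑ nm r₁) x
      (y₁ , y₂) = NonM·⊑-inv (NonM-⊑ nm r₁) y
  in  meet-greatest b p p' r₁ x₁ y₁ · meet-greatest b q q' r₂ x₂ y₂

module _ (t : Term) where

  _∨_ : P t → P t → P t
  (_ , p) ∨ (_ , q) = join (≼⇒⊑ p) (≼⇒⊑ q) , ⊑⇒≼ (⊑-join (≼⇒⊑ p) (≼⇒⊑ q))

  _∧_ : P t → P t → P t
  (_ , p) ∧ (_ , q) = meet t (≼⇒⊑ p) (≼⇒⊑ q) , ⊑⇒≼ (⊑-meet t (≼⇒⊑ p) (≼⇒⊑ q))

  P-isLattice : IsLattice (_≈P_ {t}) (_≼P_ {t}) _∨_ _∧_
  P-isLattice = record
    { isPartialOrder = On.isPartialOrder proj₁ ≼-isPartialOrder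
    ; supremum       = λ (_ , p) (_ , q) →
        let p' = ≼⇒⊑ p ; q' = ≼⇒⊑ q in
        ⊑⇒≼ (join-upperˡ p' q') , ⊑⇒≼ (join-upperʳ p' q') ,
        λ _ x y → ⊑⇒≼ (join-least p' q' (≼⇒⊑ x) (≼⇒⊑ y))
    ; infimum        = λ (_ , p) (_ , q) →
        let p' = ≼⇒⊑ p ; q' = ≼⇒⊑ q in
        ⊑⇒≼ (meet-lowerˡ t p' q') , ⊑⇒≼ (meet-lowerʳ t p' q') ,
        λ (_ , r) x y → ⊑⇒≼ (meet-greatest t p' q' (≼⇒⊑ r) (≼⇒⊑ x) (≼⇒⊑ y))
    }

theorem2p3p4 : (t : Term) → IsFiniteP t × IsLatticeP t
theorem2p3p4 t = P-finite t , _∨_ t , _∧_ t , P-isLattice t
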